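{- Let $G=(V,A)$ be a reducible flow graph with start vertex $s$, let $T$ be a rooted tree with the parent property, and let $G'$ be the derived graph of $G$ with respect to $T$. If for every vertex $v\neq s$, either $(t(v),v)\in A$ or $v$ has in-degree at least two in $G'$, then $T$ has the sibling property.
   Context: A flow graph is a finite directed graph $G=(V,A)$ with start vertex $s$ such that every vertex is reachable from $s$; there are no arcs entering $s$. A vertex $v$ dominates $w$ if every path from $s$ to $w$ contains $v$. A flow graph is reducible if every strongly connected subgraph $S$ has a single entry vertex $v$ such that every path from $s$ to a vertex of $S$ contains $v$. For a rooted tree $T$ with vertex set contained in $V$, $t(v)$ denotes the parent of $v$; ancestors and descendants include the vertex itself. $T$ has the parent property if for every arc $(v,w)\in A$, $t(w)$ is an ancestor of $v$ in $T$. $T$ has the sibling property if for all siblings $v,w$ in $T$, $v$ does not dominate $w$. For an arc $(v,w)\in A$, its derived arc is null if $w$ is an ancestor of $v$ in $T$, and otherwise is $(v',w)$, where $v'=v$ if $v=t(w)$, and otherwise $v'$ is the sibling of $w$ in $T$ that is an ancestor of $v$. The derived graph $G'$ has vertex set $V$ and arc set consisting of all non-null derived arcs of arcs in $A$. -}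

module Defs where

open import Data.Nat using (ℕ)
open import Data.Fin using (Fin)
open import Data.Fin.Subset using (Subset; _∈_; _∉_)
open import Data.Product using (Σ; ∃; _×_; _,_)
open import Data.Sum using (_⊎_)
open import Relation.Nullary using (¬_)
open import Relation.Binary.PropositionalEquality using (_≡_; _≢_)
open import Relation.Binary using (Decidable)

record Digraph (n : ℕ) : Set₁ where
  field
    Arc  : Fin n → Fin n → Set
    arc? : Decidable Arc

module _ {n : ℕ} (G : Digraph n) where
  open Digraph G

  data Walk : Fin n → Fin n → Set where
    []  : ∀ {x} → Walk x x
    _∷_ : ∀ {x y z} → Arc x y → Walk y z → Walk x z

  OnWalk : ∀ {x y} → Fin n → Walk x y → Set
  OnWalk {x} v []      = v ≡ x
  OnWalk {x} v (_ ∷ p) = v ≡ x ⊎ OnWalk v p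

  WalkWithin : ∀ {x y} → Subset n → Walk x y → Set
  WalkWithin {x} S []      = x ∈ S
  WalkWithin {x} S (_ ∷ p) = x ∈ S × WalkWithin S p

  IsFlowGraph : Fin n → Set
  IsFlowGraph s = (∀ w → Walk s w) × (∀ v → ¬ Arc v s)

  Dominates : Fin n → Fin n → Fin n → Set
  Dominates s v w = (p : Walk s w) → OnWalk v p

  StronglyConnected : Subset n → Set
  StronglyConnected S =
    (∃ λ x → x ∈ S) ×
    (∀ x y → x ∈ S → y ∈ S → Σ (Walk x y) (WalkWithin S))

  IsReducible : Fin n → Set
  IsReducible s =
    (S : Subset n) → StronglyConnected S →
    ∃ λ v → v ∈ S × (∀ x → x ∈ S → (p : Walk s x) → OnWalk v p)

-- A rooted tree whose vertex set (inT) is contained in Fin n, with root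
-- and parent function t (t is only meaningful on non-root tree vertices).
record RootedTree (n : ℕ) : Set where
  field
    inT  : Subset n
    root : Fin n
    t    : Fin n → Fin n

  data Ancestor : Fin n → Fin n → Set where
    anc-refl : ∀ {v} → v ∈ inT → Ancestor v v
    anc-step : ∀ {u v} → v ∈ inT → v ≢ root → Ancestor u (t v) → Ancestor u v

  Siblings : Fin n → Fin n → Set
  Siblings v w = v ∈ inT × w ∈ inT × v ≢ root × w ≢ root × v ≢ w × t v ≡ t w

record IsRootedTree {n : ℕ} (T : RootedTree n) : Set where
  open RootedTree T
  field
    root∈    : root ∈ inT
    parent∈  : ∀ v → v ∈ inT → v ≢ root → t v ∈ inT
    toRoot   : ∀ v → v ∈ inT → Ancestor root v

module _ {n : ℕ} (G : Digraph n) (T : RootedTree n) where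
  open Digraph G
  open RootedTree T

  -- for every arc (v,w), t(w) is an ancestor of v (so in particular w is a
  -- non-root tree vertex, making t(w) defined)
  ParentProperty : Set
  ParentProperty = ∀ v w → Arc v w → w ∈ inT × w ≢ root × Ancestor (t w) v

  SiblingProperty : Fin n → Set
  SiblingProperty s = ∀ v w → Siblings v w → ¬ Dominates G s v w

  -- (x , w) is an arc of the derived graph G' : it is the (non-null)
  -- derived arc of some arc (v , w) of G
  DerivedArc : Fin n → Fin n → Set
  DerivedArc x w = ∃ λ v → Arc v w × ¬ Ancestor w v ×
    ((v ≡ t w × x ≡ v) ⊎ (v ≢ t w × Siblings x w × Ancestor x v))

  DerivedInDegree≥2 : Fin n → Set
  DerivedInDegree≥2 w =
    ∃ λ u₁ → ∃ λ u₂ → u₁ ≢ u₂ × DerivedArc u₁ w × DerivedArc u₂ w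

module Submission where

-- Call b a *rival* of a if a and b are siblings and a dominates b; we show
-- no vertex has a rival.  Three facts drive the argument:
--  * In a flow graph, dominance is a partial order whose strict part is
--    well founded, and every closed walk of a reducible graph contains an
--    entry vertex dominating all of its vertices.
--  * With the parent property, ancestors dominate their descendants, and
--    every descendant v of x is reachable from x inside the subtree of x.
--  * By the in-degree hypothesis, every rival b of a has a rival x of a
--    that *approaches* b: a walk from x that stays in the subtree of x
--    until it reaches b.
-- Following approaches backwards from a rival gives an infinite sequence of
-- rivals, which repeats; the entry vertex of the resulting cycle shows that
-- some rival x of a dominates another rival b.  Then b is a rival of x, and
-- x is strictly dominated by a, so well-founded induction on strict
-- dominance excludes rivals altogether.

open import Defs
open import Data.Nat using (ℕ; zero; suc; _<_; _+_; _∸_; z≤n; s≤s)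
open import Data.Nat.Properties using (≤-trans; n<1+n; +-suc; m∸n+n≡m)
open import Data.Fin using (Fin; toℕ; _≟_)
open import Data.Fin.Subset using (Subset; _∈_)
open import Data.Fin.Induction using (spo-wellFounded)
open import Data.Fin.Properties using (pigeonhole)
open import Data.Vec using (tabulate)
open import Data.Vec.Properties using (lookup∘tabulate; []=⇒lookup; lookup⇒[]=)
open import Data.Bool using (true)
open import Data.Product using (Σ; ∃; ∃₂; _×_; _,_; proj₁; proj₂)
open import Data.Sum using (_⊎_; inj₁; inj₂; map₂)
open import Data.Empty using (⊥; ⊥-elim)
open import Function using (_∘_)
open import Induction.WellFounded using (WellFounded; Acc; acc)
open import Relation.Nullary using (¬_; Dec; yes; no; does)
open import Relation.Nullary.Decidable using (_⊎-dec_; dec-true)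
open import Level using (0ℓ)
open import Relation.Binary using (Rel)
open import Relation.Binary.PropositionalEquality
  using (_≡_; _≢_; refl; sym; trans; subst; cong; isEquivalence)

does-true⇒ : {A : Set} (d : Dec A) → does d ≡ true → A
does-true⇒ (yes a) _ = a
does-true⇒ (no _) ()

module _ {n : ℕ} {P : Fin n → Set} (P? : ∀ x → Dec (P x)) where

  subsetOf : Subset n
  subsetOf = tabulate (λ x → does (P? x))

  ∈-subsetOf : ∀ {x} → P x → x ∈ subsetOf
  ∈-subsetOf {x} px =
    lookup⇒[]= x subsetOf (trans (lookup∘tabulate _ x) (dec-true (P? x) px))

  subsetOf-∈ : ∀ {x} → x ∈ subsetOf → P x
  subsetOf-∈ {x} x∈ =
    does-true⇒ (P? x) (trans (sym (lookup∘tabulate _ x)) ([]=⇒lookup x∈))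

module Walks {n : ℕ} (G : Digraph n) where
  open Digraph G

  length : ∀ {x y} → Walk G x y → ℕ
  length []      = 0
  length (_ ∷ p) = suc (length p)

  infixr 5 _++_
  _++_ : ∀ {x y z} → Walk G x y → Walk G y z → Walk G x z
  []      ++ q = q
  (e ∷ p) ++ q = e ∷ (p ++ q)

  _⊆ᵥ_ : ∀ {a b c d} → Walk G a b → Walk G c d → Set
  q ⊆ᵥ p = ∀ w → OnWalk G w q → OnWalk G w p

  head-on : ∀ {x y} (p : Walk G x y) → OnWalk G x p
  head-on []      = refl
  head-on (_ ∷ p) = inj₁ refl

  head-on-≡ : ∀ {x y v} (p : Walk G x y) → x ≡ v → OnWalk G v p
  head-on-≡ p refl = head-on p

  last-on : ∀ {x y} (p : Walk G x y) → OnWalk G y p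
  last-on []      = refl
  last-on (_ ∷ p) = inj₂ (last-on p)

  on-++ : ∀ {x y z v} (p : Walk G x y) (q : Walk G y z) →
    OnWalk G v (p ++ q) → OnWalk G v p ⊎ OnWalk G v q
  on-++ []      q o         = inj₂ o
  on-++ (e ∷ p) q (inj₁ eq) = inj₁ (inj₁ eq)
  on-++ (e ∷ p) q (inj₂ o) with on-++ p q o
  ... | inj₁ o′ = inj₁ (inj₂ o′)
  ... | inj₂ o′ = inj₂ o′

  on-++ʳ : ∀ {x y z v} (p : Walk G x y) (q : Walk G y z) →
    OnWalk G v q → OnWalk G v (p ++ q)
  on-++ʳ []      q o = o
  on-++ʳ (e ∷ p) q o = inj₂ (on-++ʳ p q o)

  ++-⊆ᵥ : ∀ {a b x y z} {C : Walk G a b} (p : Walk G x y) (q : Walk G y z) →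
    p ⊆ᵥ C → q ⊆ᵥ C → (p ++ q) ⊆ᵥ C
  ++-⊆ᵥ p q p⊆C q⊆C w o with on-++ p q o
  ... | inj₁ o′ = p⊆C w o′
  ... | inj₂ o′ = q⊆C w o′

  prefix : ∀ {x z v} (p : Walk G x z) → OnWalk G v p →
    Σ (Walk G x v) λ q → q ⊆ᵥ p × (v ≢ z → length q < length p)
  prefix []      refl        = [] , (λ w o → o) , (λ v≢z → ⊥-elim (v≢z refl))
  prefix (e ∷ p) (inj₁ refl) = [] , (λ w o → inj₁ o) , (λ _ → s≤s z≤n)
  prefix (e ∷ p) (inj₂ o) with prefix p o
  ... | q , q⊆p , shorter =
    e ∷ q , (λ { w (inj₁ eq) → inj₁ eq ; w (inj₂ o′) → inj₂ (q⊆p w o′) }) ,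
    s≤s ∘ shorter

  suffix : ∀ {x z v} (p : Walk G x z) → OnWalk G v p →
    Σ (Walk G v z) λ q → q ⊆ᵥ p
  suffix []      refl        = [] , (λ w o → o)
  suffix (e ∷ p) (inj₁ refl) = e ∷ p , (λ w o → o)
  suffix (e ∷ p) (inj₂ o) with suffix p o
  ... | q , q⊆p = q , (λ w o′ → inj₂ (q⊆p w o′))

  onWalk? : ∀ {x y} (v : Fin n) (p : Walk G x y) → Dec (OnWalk G v p)
  onWalk? {x} v []      = v ≟ x
  onWalk? {x} v (_ ∷ p) = (v ≟ x) ⊎-dec onWalk? v p

module Dominance {n : ℕ} (G : Digraph n) (s : Fin n) (reach : ∀ w → Walk G s w) where
  open Digraph G
  open Walks G

  Dom : Fin n → Fin n → Set
  Dom = Dominates G s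

  dom-refl : ∀ {x} → Dom x x
  dom-refl = last-on

  dom-trans : ∀ {a b c} → Dom a b → Dom b c → Dom a c
  dom-trans a-dom-b b-dom-c p with prefix p (b-dom-c p)
  ... | q , q⊆p , _ = q⊆p _ (a-dom-b q)

  -- Two distinct vertices cannot dominate each other: a walk to x passes
  -- through y, whose shorter prefix passes through x, and so on forever.
  no-mutual-dominance : ∀ k {x y} → Dom x y → Dom y x → x ≢ y →
    (p : Walk G s x) → length p < k → ⊥
  no-mutual-dominance (suc k) x-dom-y y-dom-x x≢y p (s≤s p≤k) with prefix p (y-dom-x p)
  ... | q , _ , shorter =
    no-mutual-dominance k y-dom-x x-dom-y (x≢y ∘ sym) q (≤-trans (shorter (x≢y ∘ sym)) p≤k)

  dom-antisym : ∀ {x y} → Dom x y → Dom y x → x ≡ y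
  dom-antisym {x} {y} x-dom-y y-dom-x with x ≟ y
  ... | yes x≡y = x≡y
  ... | no  x≢y = ⊥-elim
    (no-mutual-dominance _ x-dom-y y-dom-x x≢y (reach x) (n<1+n (length (reach x))))

  dom-pred : ∀ {v w u} → Dom v w → Arc u w → v ≢ w → Dom v u
  dom-pred v-dom-w e v≢w q with on-++ q (e ∷ []) (v-dom-w (q ++ (e ∷ [])))
  ... | inj₁ o            = o
  ... | inj₂ (inj₁ refl)  = last-on q
  ... | inj₂ (inj₂ v≡w)   = ⊥-elim (v≢w v≡w)

  _⊏_ : Rel (Fin n) 0ℓ
  e ⊏ a = e ≢ a × Dom a e

  ⊏-wellFounded : WellFounded _⊏_
  ⊏-wellFounded = spo-wellFounded (record
    { isEquivalence = isEquivalence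
    ; irrefl   = λ { refl (e≢e , _) → e≢e refl }
    ; trans    = λ { (e≢a , a-dom-e) (a≢b , b-dom-a) →
                       (λ { refl → a≢b (dom-antisym a-dom-e b-dom-a) })
                     , dom-trans b-dom-a a-dom-e }
    ; <-resp-≈ = (λ { refl r → r }) , (λ { refl r → r })
    })

  module ClosedWalk {x : Fin n} (C : Walk G x x) where
    on? : ∀ z → Dec (OnWalk G z C)
    on? z = onWalk? z C

    vertices : Subset n
    vertices = subsetOf on?

    within : ∀ {u v} (p : Walk G u v) → p ⊆ᵥ C → WalkWithin G vertices p
    within []      p⊆C = ∈-subsetOf on? (p⊆C _ refl)
    within (e ∷ p) p⊆C =
      ∈-subsetOf on? (p⊆C _ (inj₁ refl)) , within p (λ w o → p⊆C w (inj₂ o))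

    strongly-connected : StronglyConnected G vertices
    strongly-connected = (x , ∈-subsetOf on? (head-on C)) , λ z₁ z₂ z₁∈C z₂∈C →
      let (q₁ , q₁⊆C)     = suffix C (subsetOf-∈ on? z₁∈C)
          (q₂ , q₂⊆C , _) = prefix C (subsetOf-∈ on? z₂∈C)
      in q₁ ++ q₂ , within (q₁ ++ q₂) (++-⊆ᵥ q₁ q₂ q₁⊆C q₂⊆C)

    entry : IsReducible G s →
      ∃ λ e → OnWalk G e C × (∀ z → OnWalk G z C → Dom e z)
    entry reducible with reducible vertices strongly-connected
    ... | e , e∈C , e-dom =
      e , subsetOf-∈ on? e∈C , λ z o → e-dom z (∈-subsetOf on? o)

  cycle-entry : IsReducible G s → ∀ {x y} (C : Walk G x y) → x ≡ y →
    ∃ λ e → OnWalk G e C × (∀ z → OnWalk G z C → Dom e z)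
  cycle-entry reducible C refl = ClosedWalk.entry C reducible

module TreeDominance {n : ℕ} (G : Digraph n) (s : Fin n) (T : RootedTree n)
  (flow : IsFlowGraph G s) (isT : IsRootedTree T) (pp : ParentProperty G T) where
  open Digraph G
  open RootedTree T
  open IsRootedTree isT
  open Walks G
  open Dominance G s (proj₁ flow) public

  anc-trans : ∀ {a b c} → Ancestor a b → Ancestor b c → Ancestor a c
  anc-trans a-b (anc-refl _)              = a-b
  anc-trans a-b (anc-step c∈T c≢r b-tc) = anc-step c∈T c≢r (anc-trans a-b b-tc)

  anc-in : ∀ {x v} → Ancestor x v → x ∈ inT
  anc-in (anc-refl x∈T)      = x∈T
  anc-in (anc-step _ _ x-tv) = anc-in x-tv

  anc-parent : ∀ {x w} → Ancestor x w → w ≢ x → Ancestor x (t w)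
  anc-parent (anc-refl _)       w≢w = ⊥-elim (w≢w refl)
  anc-parent (anc-step _ _ x-tw) _  = x-tw

  parent-ancestor : ∀ {x} → x ∈ inT → x ≢ root → Ancestor (t x) x
  parent-ancestor x∈T x≢root = anc-step x∈T x≢root (anc-refl (parent∈ _ x∈T x≢root))

  -- Subtrees can only be entered through their root: if x is an ancestor
  -- of w ≠ x, it is an ancestor of every predecessor u of w, since the
  -- parent t w is an ancestor of u.
  anc-pred : ∀ {x u w} → Arc u w → Ancestor x w → w ≢ x → Ancestor x u
  anc-pred e x-w w≢x = anc-trans (anc-parent x-w w≢x) (proj₂ (proj₂ (pp _ _ e)))

  Below : Fin n → ∀ {y z} → Walk G y z → Set
  Below x q = ∀ w → OnWalk G w q → Ancestor x w

  avoid-below : ∀ {x z y} → Ancestor x y → (p : Walk G z y) → ¬ OnWalk G x p → Below x p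
  avoid-below x-y []      x∉p w refl = x-y
  avoid-below {x} x-y (e ∷ p) x∉p = λ
    { w (inj₁ refl) → anc-pred e (p-below _ (head-on p)) (x∉p ∘ inj₂ ∘ head-on-≡ p)
    ; w (inj₂ o)    → p-below w o }
    where
    p-below : Below x p
    p-below = avoid-below x-y p (x∉p ∘ inj₂)

  -- no arc enters the root, so only the trivial walk ends there
  walk-into-root : ∀ {x} → Walk G x root → x ≡ root
  walk-into-root []      = refl
  walk-into-root (e ∷ p) with walk-into-root p
  ... | refl = ⊥-elim (proj₁ (proj₂ (pp _ _ e)) refl)

  root≡s : root ≡ s
  root≡s = sym (walk-into-root (proj₁ flow root))

  ancestor-of-root : ∀ {a} → Ancestor a root → a ≡ root
  ancestor-of-root (anc-refl _)       = refl
  ancestor-of-root (anc-step _ r≢r _) = ⊥-elim (r≢r refl)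

  -- ancestors dominate their descendants: a walk from s avoiding a would
  -- lie in the subtree of a, so a would be an ancestor of s, the root
  ancestor-dominates : ∀ {a y} → Ancestor a y → Dom a y
  ancestor-dominates {a} a-y p with onWalk? a p
  ... | yes a∈p = a∈p
  ... | no  a∉p = ⊥-elim (a∉p (head-on-≡ p s≡a))
    where
    s≡a : s ≡ a
    s≡a = sym (trans (ancestor-of-root (subst (Ancestor a) (sym root≡s)
                (avoid-below a-y p a∉p s (head-on p)))) root≡s)

  anc-antisym : ∀ {x y} → Ancestor x y → Ancestor y x → x ≡ y
  anc-antisym x-y y-x = dom-antisym (ancestor-dominates x-y) (ancestor-dominates y-x)

  parent-distinct : ∀ {x} → x ∈ inT → x ≢ root → x ≢ t x
  parent-distinct {x} x∈T x≢root x≡tx = x≢root (sym (fixed (toRoot x x∈T) refl))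
    where
    fixed : ∀ {a y} → Ancestor a y → y ≡ x → a ≡ x
    fixed (anc-refl _)        y≡x  = y≡x
    fixed (anc-step _ _ a-tx) refl = fixed a-tx (sym x≡tx)

  -- a sibling x of a is not an ancestor of a: otherwise x and its
  -- parent t a = t x would be ancestors of each other
  sibling-not-ancestor : ∀ {x a} → t x ≡ t a → x ≢ a → x ∈ inT → x ≢ root →
    ¬ Ancestor x a
  sibling-not-ancestor tx≡ta x≢a x∈T x≢root x-a =
    parent-distinct x∈T x≢root
      (anc-antisym (subst (Ancestor _) (sym tx≡ta) (anc-parent x-a (x≢a ∘ sym)))
                   (parent-ancestor x∈T x≢root))

  -- from a visit of x on a walk into its subtree, the walk can be cut to a
  -- walk from x that stays in the subtree (cut at the last visit of x)
  enter-subtree : ∀ {x z y} → Ancestor x y → (p : Walk G z y) → OnWalk G x p →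
    Σ (Walk G x y) (Below x)
  enter-subtree x-y []      refl = [] , λ { w refl → x-y }
  enter-subtree x-y (e ∷ p) x∈p with onWalk? _ p | x∈p
  ... | yes x∈p′ | _         = enter-subtree x-y p x∈p′
  ... | no  x∉p′ | inj₂ x∈p′ = ⊥-elim (x∉p′ x∈p′)
  ... | no  x∉p′ | inj₁ refl = e ∷ p , λ
    { w (inj₁ refl) → anc-refl (anc-in x-y)
    ; w (inj₂ o)    → avoid-below x-y p x∉p′ w o }

  subtree-walk : ∀ {x v} → Ancestor x v → Σ (Walk G x v) (Below x)
  subtree-walk {v = v} x-v = enter-subtree x-v (proj₁ flow v) (ancestor-dominates x-v _)

  subtree-dominates : ∀ {v u x} → Dom v u → (q : Walk G x u) → Below x q →
    ¬ Ancestor x v → Dom v x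
  subtree-dominates v-dom-u q q-below v∉subtree p with on-++ p q (v-dom-u (p ++ q))
  ... | inj₁ v∈p = v∈p
  ... | inj₂ v∈q = ⊥-elim (v∉subtree (q-below _ v∈q))

module SiblingArgument {n : ℕ} (G : Digraph n) (s : Fin n) (T : RootedTree n)
  (flow : IsFlowGraph G s) (reducible : IsReducible G s)
  (isT : IsRootedTree T) (pp : ParentProperty G T)
  (entered : ∀ v → v ≢ s → Digraph.Arc G (RootedTree.t T v) v ⊎ DerivedInDegree≥2 G T v)
  where
  open Digraph G
  open RootedTree T
  open IsRootedTree isT
  open Walks G
  open TreeDominance G s T flow isT pp public

  record Rival (a b : Fin n) : Set where
    field
      b∈T         : b ∈ inT
      b≢root      : b ≢ root
      same-parent : t b ≡ t a
      b≢a         : b ≢ a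
      a-dom-b     : Dom a b
  open Rival

  Approach : Fin n → Fin n → Set
  Approach x b = x ≢ b ×
    Σ (Walk G x b) λ W → ∀ z → OnWalk G z W → z ≡ b ⊎ Ancestor x z

  -- a cannot dominate a sibling b entered from the common parent t b = t a:
  -- a would dominate t a, which dominates a
  parent-arc-impossible : ∀ {a b} → a ∈ inT → a ≢ root → Rival a b → ¬ Arc (t b) b
  parent-arc-impossible a∈T a≢root r e =
    parent-distinct a∈T a≢root
      (dom-antisym (subst (Dom _) (same-parent r) (dom-pred (a-dom-b r) e (b≢a r ∘ sym)))
                   (ancestor-dominates (parent-ancestor a∈T a≢root)))

  -- A derived arc (x , b) into a rival b of a, with x ≠ a, comes from an
  -- arc (v , b) with v in the subtree of the sibling x of b; then x is a
  -- rival of a approaching b.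
  derived-arc-approach : ∀ {a b x} → a ∈ inT → a ≢ root → Rival a b → x ≢ a →
    DerivedArc G T x b → Rival a x × Approach x b
  derived-arc-approach a∈T a≢root r x≢a (v , e , _ , inj₁ (refl , refl)) =
    ⊥-elim (parent-arc-impossible a∈T a≢root r e)
  derived-arc-approach {a} {b} {x} a∈T a≢root r x≢a
    (v , e , _ , inj₂ (_ , (x∈T , _ , x≢root , _ , x≢b , tx≡tb) , x-v))
    with subtree-walk x-v
  ... | q , q-below = rival , x≢b , q ++ (e ∷ []) , in-subtree
    where
    tx≡ta : t x ≡ t a
    tx≡ta = trans tx≡tb (same-parent r)

    rival : Rival a x
    rival = record
      { b∈T = x∈T ; b≢root = x≢root ; same-parent = tx≡ta ; b≢a = x≢a
      ; a-dom-b = subtree-dominates (dom-pred (a-dom-b r) e (b≢a r ∘ sym)) q q-below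
                    (sibling-not-ancestor tx≡ta x≢a x∈T x≢root) }

    in-subtree : ∀ z → OnWalk G z (q ++ (e ∷ [])) → z ≡ b ⊎ Ancestor x z
    in-subtree z o with on-++ q (e ∷ []) o
    ... | inj₁ z∈q         = inj₂ (q-below z z∈q)
    ... | inj₂ (inj₁ refl) = inj₂ x-v
    ... | inj₂ (inj₂ z≡b)  = inj₁ z≡b

  -- every rival b of a is approached by another rival of a: b is not
  -- entered from its parent, so it has two derived in-arcs, one not from a
  rival-predecessor : ∀ {a} → a ∈ inT → a ≢ root →
    ∀ b → Rival a b → Σ (Fin n) λ x → Rival a x × Approach x b
  rival-predecessor {a} a∈T a≢root b r
    with entered b (b≢root r ∘ λ b≡s → trans b≡s (sym root≡s))
  ... | inj₁ e = ⊥-elim (parent-arc-impossible a∈T a≢root r e)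
  ... | inj₂ (u₁ , u₂ , u₁≢u₂ , d₁ , d₂) with u₁ ≟ a
  ...   | yes refl = u₂ , derived-arc-approach a∈T a≢root r (u₁≢u₂ ∘ sym) d₂
  ...   | no  u₁≢a = u₁ , derived-arc-approach a∈T a≢root r u₁≢a d₁

  module BackwardChain (P : Fin n → Set)
    (predecessor : ∀ b → P b → Σ (Fin n) λ x → P x × Approach x b)
    (b₀ : Fin n) (p₀ : P b₀) where

    next : Σ (Fin n) P → Σ (Fin n) P
    next (b , pb) = proj₁ (predecessor b pb) , proj₁ (proj₂ (predecessor b pb))

    approach-next : ∀ c → Approach (proj₁ (next c)) (proj₁ c)
    approach-next (b , pb) = proj₂ (proj₂ (predecessor b pb))

    chain : ℕ → Σ (Fin n) P
    chain zero    = b₀ , p₀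
    chain (suc k) = next (chain k)

    vtx : ℕ → Fin n
    vtx k = proj₁ (chain k)

    step : ∀ k → Approach (vtx (suc k)) (vtx k)
    step k = approach-next (chain k)

    segment : ∀ k → Walk G (vtx (suc k)) (vtx k)
    segment k = proj₁ (proj₂ (step k))

    path : ∀ i d → Walk G (vtx (d + i)) (vtx i)
    path i zero    = []
    path i (suc d) = segment (d + i) ++ path i d

    Covered : ∀ {x y} → Walk G x y → Fin n → Set
    Covered C z = ∃ λ k → Dom (vtx (suc k)) z × OnWalk G (vtx (suc k)) C × OnWalk G (vtx k) C

    covered-++ʳ : ∀ {x y z u} (W : Walk G x y) {C : Walk G y z} → Covered C u → Covered (W ++ C) u
    covered-++ʳ W (k , dom , on₁ , on₀) = k , dom , on-++ʳ W _ on₁ , on-++ʳ W _ on₀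

    path-covered : ∀ i d z → OnWalk G z (path i d) → z ≡ vtx i ⊎ Covered (path i d) z
    path-covered i zero    z o = inj₁ o
    path-covered i (suc d) z o with on-++ (segment (d + i)) (path i d) o
    ... | inj₂ o′ = map₂ (covered-++ʳ (segment (d + i))) (path-covered i d z o′)
    ... | inj₁ o′ with proj₂ (proj₂ (step (d + i))) z o′
    ...   | inj₂ anc  = inj₂ (d + i , ancestor-dominates anc , head-on _
                             , on-++ʳ (segment (d + i)) _ (head-on (path i d)))
    ...   | inj₁ refl = map₂ (covered-++ʳ (segment (d + i))) (path-covered i d z (head-on (path i d)))

    -- on a closed path, the exceptional end vertex b_i is its start b_{d+1+i}
    closed-covered : ∀ i d → vtx (suc d + i) ≡ vtx i →
      ∀ z → OnWalk G z (path i (suc d)) → Covered (path i (suc d)) z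
    closed-covered i d closed z o with path-covered i (suc d) z o
    ... | inj₂ covered = covered
    ... | inj₁ refl    = d + i , subst (Dom _) closed dom-refl , head-on _
                       , on-++ʳ (segment (d + i)) _ (head-on (path i d))

    covered-entry : ∀ {x y e} (C : Walk G x y) → (∀ z → OnWalk G z C → Dom e z) →
      Covered C e → ∃ λ k → Dom (vtx (suc k)) (vtx k)
    covered-entry C e-dom (k , dom , on₁ , on₀) =
      k , subst (λ u → Dom u (vtx k)) (dom-antisym (e-dom _ on₁) dom) (e-dom _ on₀)

    closed-path-step : ∀ i d → vtx (suc d + i) ≡ vtx i → ∃ λ k → Dom (vtx (suc k)) (vtx k)
    closed-path-step i d closed with cycle-entry reducible (path i (suc d)) closed
    ... | e , e∈C , e-dom = covered-entry _ e-dom (closed-covered i d closed e e∈C)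

    dominating-step : ∃ λ k → Dom (vtx (suc k)) (vtx k)
    dominating-step with pigeonhole (n<1+n n) (λ j → vtx (toℕ j))
    ... | i , j , i<j , bᵢ≡bⱼ = closed-path-step (toℕ i) d
      (trans (cong vtx (trans (sym (+-suc d (toℕ i))) (m∸n+n≡m i<j))) (sym bᵢ≡bⱼ))
      where
      d : ℕ
      d = toℕ j ∸ suc (toℕ i)

    dominating-pair : ∃₂ λ x b → P x × P b × x ≢ b × Dom x b
    dominating-pair with dominating-step
    ... | k , dom = vtx (suc k) , vtx k , proj₂ (chain (suc k)) , proj₂ (chain k)
                  , proj₁ (step k) , dom

  rival-of-rival : ∀ {a x b} → Rival a x → Rival a b → x ≢ b → Dom x b → Rival x b
  rival-of-rival rx rb x≢b x-dom-b = record
    { b∈T = b∈T rb ; b≢root = b≢root rb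
    ; same-parent = trans (same-parent rb) (sym (same-parent rx))
    ; b≢a = x≢b ∘ sym ; a-dom-b = x-dom-b }

  -- No vertex has a rival, by well-founded induction on strict dominance:
  -- a rival of a yields a rival x of a that has a rival, and x ⊏ a.
  no-rival : ∀ a → Acc _⊏_ a → a ∈ inT → a ≢ root → ∀ b → ¬ Rival a b
  no-rival a (acc smaller) a∈T a≢root b rb =
    descend (BackwardChain.dominating-pair (Rival a) (rival-predecessor a∈T a≢root) b rb)
    where
    descend : (∃₂ λ x b′ → Rival a x × Rival a b′ × x ≢ b′ × Dom x b′) → ⊥
    descend (x , b′ , rx , rb′ , x≢b′ , x-dom-b′) =
      no-rival x (smaller (b≢a rx , a-dom-b rx)) (b∈T rx) (b≢root rx) b′
        (rival-of-rival rx rb′ x≢b′ x-dom-b′)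

lemma20 : {n : ℕ} (G : Digraph n) (s : Fin n) (T : RootedTree n) →
    IsFlowGraph G s → IsReducible G s →
    IsRootedTree T → ParentProperty G T →
    (∀ v → v ≢ s →
       Digraph.Arc G (RootedTree.t T v) v ⊎ DerivedInDegree≥2 G T v) →
    SiblingProperty G T s
lemma20 G s T flow reducible isT pp entered v w (v∈T , w∈T , v≢root , w≢root , v≢w , tv≡tw) v-dom-w =
  no-rival v (⊏-wellFounded v) v∈T v≢root w w-rival-of-v
  where
  open SiblingArgument G s T flow reducible isT pp entered

  w-rival-of-v : Rival v w
  w-rival-of-v = record
    { b∈T = w∈T ; b≢root = w≢root ; same-parent = sym tv≡tw
    ; b≢a = v≢w ∘ sym ; a-dom-b = v-dom-w }
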